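{- Let $\mathcal{B}_n(P)$ denote the set of t-shelves of size $n$ in which no node that is a left child of its parent has a right child. Then $$\sum_{n\ge 0} |\mathcal{B}_n(P)|\,\frac{z^n}{n!} = e^{e^{z}-1},$$ so $|\mathcal{B}_n(P)|$ is the $n$th Bell number (the number of set partitions of an $n$-element set).
   Context: A treeshelf (t-shelf) of size $n\ge 1$ is a rooted binary tree with $n$ nodes labeled bijectively by $\{1,\dots,n\}$ so that labels strictly increase along every path starting at the root, in which every node has at most one left child and at most one right child, and every child (including a child with no sibling) is designated either as the left child or the right child of its parent. There is a unique empty t-shelf, of size $0$. -}

module Defs where

open import Data.Nat using (ℕ; zero; suc; _+_; _*_; _<ᵇ_; _≡ᵇ_)
open import Data.Bool using (Bool; true; false; _∧_; T)
open import Data.List using (List; []; _∷_; _++_; length; upTo; map)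
open import Data.Bool.ListAction using (all)
open import Data.Nat.ListAction using (sum)
open import Data.Product using (Σ)

-- Binary trees in which each child occupies a definite slot (left / right),
-- with a natural-number label at every node.  'leaf' is the absence of a node.
data Tree : Set where
  leaf : Tree
  node : (l : Tree) → (a : ℕ) → (r : Tree) → Tree

labels : Tree → List ℕ
labels leaf = []
labels (node l a r) = a ∷ (labels l ++ labels r)

count : ℕ → List ℕ → ℕ
count k [] = 0
count k (x ∷ xs) with k ≡ᵇ x
... | true  = suc (count k xs)
... | false = count k xs

labelledBy : ℕ → Tree → Bool
labelledBy n t =
  (length (labels t) ≡ᵇ n) ∧ all (λ i → count (suc i) (labels t) ≡ᵇ 1) (upTo n)

above : ℕ → Tree → Bool
above a leaf = true
above a (node _ b _) = a <ᵇ b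

increasing : Tree → Bool
increasing leaf = true
increasing (node l a r) = above a l ∧ above a r ∧ increasing l ∧ increasing r

isTShelf : ℕ → Tree → Bool
isTShelf n t = labelledBy n t ∧ increasing t

noRightChild : Tree → Bool
noRightChild leaf = true
noRightChild (node _ _ leaf) = true
noRightChild (node _ _ (node _ _ _)) = false

propP : Tree → Bool
propP leaf = true
propP (node l a r) = noRightChild l ∧ propP l ∧ propP r

-- 𝓑ₙ(P): t-shelves of size n with property P
-- (T of a Bool is proof-irrelevant, so this is a subset of Tree)
B : ℕ → Set
B n = Σ Tree (λ t → T (isTShelf n t ∧ propP t))

stirling2 : ℕ → ℕ → ℕ
stirling2 zero zero = 1
stirling2 zero (suc k) = 0
stirling2 (suc n) zero = 0
stirling2 (suc n) (suc k) = suc k * stirling2 n (suc k) + stirling2 n k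

bell : ℕ → ℕ
bell n = sum (map (stirling2 n) (upTo (suc n)))

{-# OPTIONS --safe #-}
module Submission where

-- Property P says that every left subtree is a left chain, so a t-shelf with P is its right
-- spine with one increasing left chain hanging from each spine node; these are the blocks of a
-- set partition of {1,…,n}. The largest label n+1 of a t-shelf of size n+1 is a leaf, at the
-- bottom of one of the k chains or at the end of the spine. Deleting it therefore identifies
-- the t-shelves of size n+1 with k spine nodes with the t-shelves of size n with k spine nodes
-- and a chosen chain, plus those with k-1 spine nodes: the recurrence
-- S(n+1,k) = k S(n,k) + S(n,k-1). Summing over the spine length k ≤ n gives the Bell number.

open import Defs
open import Data.Bool using (T; _∧_; true; false)
open import Data.Bool.Properties using (T-∧; T-irrelevant)
open import Data.Nat using (ℕ; zero; suc; _≤_; _<_; z≤n; s≤s; _≡ᵇ_)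
open import Data.Nat.ListAction using (sum)
open import Data.Nat.Properties
  using (_≟_; ≡ᵇ⇒≡; ≡⇒≡ᵇ; <ᵇ⇒<; <⇒<ᵇ; <⇒≢; >⇒≢; <⇒≱; <-irrefl; ≤-refl; ≤-reflexive; ≤-trans;
         m≤n+m; m≤n⇒m<n∨m≡n; m<n⇒m<1+n; m≤n⇒m≤1+n; suc-injective; 0≢1+n; ≡-irrelevant)
open import Data.Fin using (Fin; zero; suc; toℕ; fromℕ<)
open import Data.Fin.Properties using (toℕ-fromℕ<; toℕ-injective; +↔⊎; *↔×; 1↔⊤)
open import Data.List using ([]; _∷_; _++_; length; filter; map; applyUpTo; applyDownFrom; upTo)
open import Data.List.Properties using (map-upTo; length-++; length-applyDownFrom)
open import Data.List.Relation.Unary.All as All using (All; []; _∷_)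
open import Data.List.Relation.Unary.All.Properties using (++⁻ˡ; ++⁻ʳ; all⁺; all⁻; applyUpTo⁺₁; applyUpTo⁻)
open import Data.List.Relation.Unary.Any using (here; there)
open import Data.List.Membership.Propositional using (_∈_; _∉_)
open import Data.List.Membership.Propositional.Properties using (∈-++⁻; ∈-∃++)
open import Data.List.Membership.DecPropositional _≟_ using (_∈?_)
open import Data.List.Relation.Binary.Permutation.Propositional using (_↭_; ↭-refl; ↭-trans; ↭-sym; prep; swap)
open import Data.List.Relation.Binary.Permutation.Propositional.Properties
  using (All-resp-↭; ∈-resp-↭; ↭-length; ↭-empty-inv; drop-∷; shift; ++⁺ˡ; ++⁺ʳ; filter-↭)
import Data.Product as Product
open import Data.Product using (Σ; _×_; _,_; proj₁; proj₂; uncurry)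
open import Data.Product.Function.Dependent.Propositional using (Σ-↔)
open import Data.Product.Function.NonDependent.Propositional using (_×-↔_)
import Data.Sum as Sum
open import Data.Sum using (_⊎_; inj₁; inj₂)
open import Data.Sum.Function.Propositional using (_⊎-↔_)
open import Data.Unit using (⊤; tt)
open import Data.Empty using (⊥-elim)
open import Function using (_∘_; id)
open import Function.Bundles using (_↔_; _⇔_; mk↔ₛ′; mk⇔; Equivalence)
open import Function.Properties.Inverse using (↔-refl; ↔-sym; ↔-trans)
open import Function.Related.Propositional using (module EquationalReasoning)
open import Function.Related.TypeIsomorphisms using (Σ-assoc; Σ-distribˡ-⊎; Σ-distribʳ-⊎)
open import Relation.Nullary using (¬_; yes; no; contradiction)
open import Relation.Nullary.Decidable using (dec-true; dec-false)
open import Relation.Binary.PropositionalEquality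
  using (_≡_; _≢_; refl; sym; trans; cong; cong₂; subst; subst-subst-sym; subst-sym-subst)

-- Bijections between finite types

¬⇒↔Fin0 : ∀ {A : Set} → ¬ A → A ↔ Fin 0
¬⇒↔Fin0 ¬a = mk↔ₛ′ (⊥-elim ∘ ¬a) (λ ()) (λ ()) (⊥-elim ∘ ¬a)

⊤×↔ : ∀ {A : Set} → (⊤ × A) ↔ A
⊤×↔ = mk↔ₛ′ proj₂ (tt ,_) (λ _ → refl) (λ _ → refl)

suc≡suc↔ : ∀ {m n : ℕ} → (suc m ≡ suc n) ↔ (m ≡ n)
suc≡suc↔ = mk↔ₛ′ (λ { refl → refl }) (λ { refl → refl }) (λ { refl → refl }) (λ { refl → refl })

≡-substˡ-↔ : ∀ {m m′ k : ℕ} → m ≡ m′ → (m ≡ k) ↔ (m′ ≡ k)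
≡-substˡ-↔ refl = ↔-refl

Σ-Fin-suc↔ : ∀ {m} (P : Fin (suc m) → Set) → Σ (Fin (suc m)) P ↔ (P zero ⊎ Σ (Fin m) (P ∘ suc))
Σ-Fin-suc↔ P = mk↔ₛ′ to from to∘from from∘to
  where
  to : Σ _ P → P zero ⊎ Σ _ (P ∘ suc)
  to (zero  , p) = inj₁ p
  to (suc i , p) = inj₂ (i , p)
  from : P zero ⊎ Σ _ (P ∘ suc) → Σ _ P
  from (inj₁ p)       = zero , p
  from (inj₂ (i , p)) = suc i , p
  to∘from : ∀ q → to (from q) ≡ q
  to∘from (inj₁ _) = refl
  to∘from (inj₂ _) = refl
  from∘to : ∀ q → from (to q) ≡ q
  from∘to (zero  , _) = refl
  from∘to (suc _ , _) = refl

Fin-sum-applyUpTo↔ : ∀ (f : ℕ → ℕ) m → Fin (sum (applyUpTo f m)) ↔ Σ (Fin m) (λ i → Fin (f (toℕ i)))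
Fin-sum-applyUpTo↔ f zero    = mk↔ₛ′ (λ ()) (λ ()) (λ ()) (λ ())
Fin-sum-applyUpTo↔ f (suc m) =
  ↔-trans +↔⊎ (↔-trans (↔-refl ⊎-↔ Fin-sum-applyUpTo↔ (f ∘ suc) m) (↔-sym (Σ-Fin-suc↔ _)))

Fin-sum-upTo↔ : ∀ (f : ℕ → ℕ) m → Fin (sum (map f (upTo m))) ↔ Σ (Fin m) (λ i → Fin (f (toℕ i)))
Fin-sum-upTo↔ f m rewrite map-upTo f m = Fin-sum-applyUpTo↔ f m

↔Σ-fibres : ∀ {A : Set} {m} (f : A → ℕ) → (∀ a → f a < m) →
            A ↔ Σ (Fin m) (λ i → Σ A (λ a → f a ≡ toℕ i))
↔Σ-fibres {A} {m} f f<m = mk↔ₛ′ to (proj₁ ∘ proj₂) to∘from (λ _ → refl)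
  where
  Fibres = Σ (Fin m) (λ i → Σ A (λ a → f a ≡ toℕ i))
  to : A → Fibres
  to a = fromℕ< (f<m a) , a , sym (toℕ-fromℕ< (f<m a))
  fibre-≡ : ∀ {i j a} (e : f a ≡ toℕ i) (e′ : f a ≡ toℕ j) → i ≡ j →
            _≡_ {A = Fibres} (i , a , e) (j , a , e′)
  fibre-≡ e e′ refl = cong (λ e → _ , _ , e) (≡-irrelevant e e′)
  to∘from : ∀ x → to (proj₁ (proj₂ x)) ≡ x
  to∘from (i , a , e) = fibre-≡ _ e (toℕ-injective (trans (toℕ-fromℕ< (f<m a)) e))

Fin-×-fibre↔ : ∀ {A : Set} {m} (f : A → ℕ) →
               Σ A (λ a → Fin (f a) × f a ≡ m) ↔ (Fin m × Σ A (λ a → f a ≡ m))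
Fin-×-fibre↔ f = mk↔ₛ′
  (λ (a , i , e) → subst Fin e i , a , e)
  (λ (i , a , e) → a , subst Fin (sym e) i , e)
  (λ (i , a , e) → cong (_, a , e) (subst-subst-sym e))
  (λ (a , i , e) → cong (λ j → a , j , e) (subst-sym-subst e))

stirling2-↔ : (S : ℕ → ℕ → Set) →
              S 0 0 ↔ ⊤ → (∀ k → ¬ S 0 (suc k)) → (∀ n → ¬ S (suc n) 0) →
              (∀ n k → S (suc n) (suc k) ↔ (Fin (suc k) × S n (suc k) ⊎ S n k)) →
              ∀ n k → S n k ↔ Fin (stirling2 n k)
stirling2-↔ S S₀₀ ¬S₀ₖ ¬Sₙ₀ S-suc = go
  where
  go : ∀ n k → S n k ↔ Fin (stirling2 n k)
  go zero    zero    = ↔-trans S₀₀ (↔-sym 1↔⊤)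
  go zero    (suc k) = ¬⇒↔Fin0 (¬S₀ₖ k)
  go (suc n) zero    = ¬⇒↔Fin0 (¬Sₙ₀ n)
  go (suc n) (suc k) =
    ↔-trans (S-suc n k)
      (↔-trans ((↔-refl ×-↔ go n (suc k)) ⊎-↔ go n k)
        (↔-trans (↔-sym *↔× ⊎-↔ ↔-refl) (↔-sym +↔⊎)))

-- Labellings as permutations of [n, …, 1]

T-∧⁻ : ∀ x {y} → T (x ∧ y) → T x × T y
T-∧⁻ x = Equivalence.to (T-∧ {x})

T-∧⁺ : ∀ {x y} → T x → T y → T (x ∧ y)
T-∧⁺ p q = Equivalence.from T-∧ (p , q)

All<⇒∉ : ∀ {x xs} → All (_< x) xs → x ∉ xs
All<⇒∉ <x x∈ = <-irrefl refl (All.lookup <x x∈)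

count-filter : ∀ k xs → count k xs ≡ length (filter (k ≟_) xs)
count-filter k []       = refl
count-filter k (x ∷ xs) with k ≡ᵇ x
... | true  = cong suc (count-filter k xs)
... | false = count-filter k xs

count-↭ : ∀ k {xs ys} → xs ↭ ys → count k xs ≡ count k ys
count-↭ k {xs} {ys} p =
  trans (count-filter k xs) (trans (↭-length (filter-↭ (k ≟_) p)) (sym (count-filter k ys)))

count-∷-≡ : ∀ k xs → count k (k ∷ xs) ≡ suc (count k xs)
count-∷-≡ k xs rewrite dec-true (k ≟ k) refl = refl

count-∷-≢ : ∀ {k x} xs → k ≢ x → count k (x ∷ xs) ≡ count k xs
count-∷-≢ {k} {x} xs k≢x rewrite dec-false (k ≟ x) k≢x = refl

count-∉ : ∀ {k} xs → k ∉ xs → count k xs ≡ 0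
count-∉ []       _  = refl
count-∉ (x ∷ xs) k∉ = trans (count-∷-≢ xs (k∉ ∘ here)) (count-∉ xs (k∉ ∘ there))

count⇒∈ : ∀ {k xs c} → count k xs ≡ suc c → k ∈ xs
count⇒∈ {k} {xs} eq with k ∈? xs
... | yes k∈ = k∈
... | no k∉  = contradiction (trans (sym (count-∉ xs k∉)) eq) 0≢1+n

applyDownFrom-≤ : ∀ n → All (_≤ n) (applyDownFrom suc n)
applyDownFrom-≤ zero    = []
applyDownFrom-≤ (suc n) = ≤-refl ∷ All.map m≤n⇒m≤1+n (applyDownFrom-≤ n)

count-applyDownFrom : ∀ {i n} → i < n → count (suc i) (applyDownFrom suc n) ≡ 1
count-applyDownFrom {i} {suc m} (s≤s i≤m) with m≤n⇒m<n∨m≡n i≤m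
... | inj₁ i<m  = trans (count-∷-≢ _ (<⇒≢ (s≤s i<m))) (count-applyDownFrom i<m)
... | inj₂ refl =
  trans (count-∷-≡ (suc i) (applyDownFrom suc i))
        (cong suc (count-∉ (applyDownFrom suc i) (All<⇒∉ (All.map s≤s (applyDownFrom-≤ i)))))

↭-applyDownFrom : ∀ n xs → length xs ≡ n → (∀ {i} → i < n → count (suc i) xs ≡ 1) →
                  xs ↭ applyDownFrom suc n
↭-applyDownFrom zero    []       _ _ = ↭-refl
↭-applyDownFrom (suc n) xs len cnt with ∈-∃++ (count⇒∈ {xs = xs} (cnt {n} ≤-refl))
... | ys , zs , refl = ↭-trans xs↭ (prep (suc n) (↭-applyDownFrom n (ys ++ zs) len′ cnt′))
  where
  xs↭ = shift (suc n) ys zs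
  len′ : length (ys ++ zs) ≡ n
  len′ = suc-injective (trans (sym (↭-length xs↭)) len)
  cnt′ : ∀ {i} → i < n → count (suc i) (ys ++ zs) ≡ 1
  cnt′ i<n = trans (sym (count-∷-≢ (ys ++ zs) (<⇒≢ (s≤s i<n))))
                   (trans (sym (count-↭ _ xs↭)) (cnt (m<n⇒m<1+n i<n)))

labelledBy⇔ : ∀ n t → T (labelledBy n t) ⇔ (labels t ↭ applyDownFrom suc n)
labelledBy⇔ n t = mk⇔ to from
  where
  to : T (labelledBy n t) → labels t ↭ applyDownFrom suc n
  to lb =
    let len , cnt = T-∧⁻ (length (labels t) ≡ᵇ n) lb
    in ↭-applyDownFrom n (labels t) (≡ᵇ⇒≡ _ _ len)
         (λ i<n → ≡ᵇ⇒≡ _ _ (applyUpTo⁻ id n (all⁺ _ (upTo n) cnt) i<n))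
  from : labels t ↭ applyDownFrom suc n → T (labelledBy n t)
  from p =
    T-∧⁺ (≡⇒≡ᵇ _ _ (trans (↭-length p) (length-applyDownFrom suc n)))
         (all⁻ _ (applyUpTo⁺₁ id n λ i<n → ≡⇒≡ᵇ _ _ (trans (count-↭ _ p) (count-applyDownFrom i<n))))

-- Inserting and deleting a largest label

spineLength : Tree → ℕ
spineLength leaf         = 0
spineLength (node _ _ r) = suc (spineLength r)

-- inj₁ i: at the bottom of the left chain hanging from the i-th spine node;
-- inj₂ tt: at the end of the right spine.
Slot : Tree → Set
Slot t = Fin (spineLength t) ⊎ ⊤

extendLeftPath : ℕ → Tree → Tree
extendLeftPath x leaf         = node leaf x leaf
extendLeftPath x (node l a r) = node (extendLeftPath x l) a r

trimLeftPath : Tree → Tree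
trimLeftPath leaf                      = leaf
trimLeftPath (node leaf _ r)           = r
trimLeftPath (node l@(node _ _ _) a r) = node (trimLeftPath l) a r

insert : ℕ → (t : Tree) → Slot t → Tree
insert x leaf         (inj₂ _)       = node leaf x leaf
insert x (node l a r) (inj₁ zero)    = node (extendLeftPath x l) a r
insert x (node l a r) (inj₁ (suc i)) = node l a (insert x r (inj₁ i))
insert x (node l a r) (inj₂ u)       = node l a (insert x r (inj₂ u))

-- Only meaningful when x is the largest label: a root labelled x is then a single node.
delete : ℕ → Tree → Σ Tree Slot
delete x leaf         = leaf , inj₂ tt
delete x (node l a r) with x ≟ a | x ∈? labels l
... | yes _ | _     = leaf , inj₂ tt
... | no _  | yes _ = node (trimLeftPath l) a r , inj₁ zero
... | no _  | no _  = Product.map (node l a) (Sum.map₁ suc) (delete x r)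

trimLeftPath-extendLeftPath : ∀ x t → trimLeftPath (extendLeftPath x t) ≡ t
trimLeftPath-extendLeftPath x leaf                      = refl
trimLeftPath-extendLeftPath x (node leaf a r)           = refl
trimLeftPath-extendLeftPath x (node l@(node _ _ _) a r) =
  cong (λ l → node l a r) (trimLeftPath-extendLeftPath x l)

labels-node-left : ∀ {x l′ l a r} → labels l′ ↭ x ∷ labels l →
                   labels (node l′ a r) ↭ x ∷ labels (node l a r)
labels-node-left {x} {a = a} {r} p = ↭-trans (prep a (++⁺ʳ (labels r) p)) (swap a x ↭-refl)

labels-node-right : ∀ {x r′ l a r} → labels r′ ↭ x ∷ labels r →
                    labels (node l a r′) ↭ x ∷ labels (node l a r)
labels-node-right {x} {l = l} {a} {r} p =
  ↭-trans (prep a (↭-trans (++⁺ˡ (labels l) p) (shift x (labels l) (labels r)))) (swap a x ↭-refl)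

labels-extendLeftPath : ∀ x t → labels (extendLeftPath x t) ↭ x ∷ labels t
labels-extendLeftPath x leaf         = ↭-refl
labels-extendLeftPath x (node l a r) = labels-node-left (labels-extendLeftPath x l)

labels-insert : ∀ x t s → labels (insert x t s) ↭ x ∷ labels t
labels-insert x leaf         (inj₂ _)       = ↭-refl
labels-insert x (node l a r) (inj₁ zero)    = labels-node-left (labels-extendLeftPath x l)
labels-insert x (node l a r) (inj₁ (suc i)) = labels-node-right (labels-insert x r (inj₁ i))
labels-insert x (node l a r) (inj₂ u)       = labels-node-right (labels-insert x r (inj₂ u))

spineLength-insert₁ : ∀ x t i → spineLength (insert x t (inj₁ i)) ≡ spineLength t
spineLength-insert₁ x (node l a r) zero    = refl
spineLength-insert₁ x (node l a r) (suc i) = cong suc (spineLength-insert₁ x r i)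

spineLength-insert₂ : ∀ x t u → spineLength (insert x t (inj₂ u)) ≡ suc (spineLength t)
spineLength-insert₂ x leaf         _ = refl
spineLength-insert₂ x (node l a r) u = cong suc (spineLength-insert₂ x r u)

delete-insert : ∀ x t s → All (_< x) (labels t) → delete x (insert x t s) ≡ (t , s)
delete-insert x leaf (inj₂ _) _ with x ≟ x
... | yes _  = refl
... | no x≢x = contradiction refl x≢x
delete-insert x (node l a r) (inj₁ zero) (a<x ∷ _) with x ≟ a | x ∈? labels (extendLeftPath x l)
... | yes x≡a | _     = contradiction x≡a (>⇒≢ a<x)
... | no _    | yes _ = cong (λ l → node l a r , inj₁ zero) (trimLeftPath-extendLeftPath x l)
... | no _    | no x∉ = contradiction (∈-resp-↭ (↭-sym (labels-extendLeftPath x l)) (here refl)) x∉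
delete-insert x (node l a r) (inj₁ (suc i)) (a<x ∷ <x) with x ≟ a | x ∈? labels l
... | yes x≡a | _      = contradiction x≡a (>⇒≢ a<x)
... | no _    | yes x∈ = contradiction x∈ (All<⇒∉ (++⁻ˡ (labels l) <x))
... | no _    | no _   =
  cong (Product.map (node l a) (Sum.map₁ suc)) (delete-insert x r (inj₁ i) (++⁻ʳ (labels l) <x))
delete-insert x (node l a r) (inj₂ u) (a<x ∷ <x) with x ≟ a | x ∈? labels l
... | yes x≡a | _      = contradiction x≡a (>⇒≢ a<x)
... | no _    | yes x∈ = contradiction x∈ (All<⇒∉ (++⁻ˡ (labels l) <x))
... | no _    | no _   =
  cong (Product.map (node l a) (Sum.map₁ suc)) (delete-insert x r (inj₂ u) (++⁻ʳ (labels l) <x))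

insert-right : ∀ x l b (d : Σ Tree Slot) →
               uncurry (insert x) (Product.map (node l b) (Sum.map₁ suc) d) ≡ node l b (uncurry (insert x) d)
insert-right x l b (r , inj₁ i) = refl
insert-right x l b (r , inj₂ u) = refl

∈-right : ∀ {x l b r} → x ∈ labels (node l b r) → x ≢ b → x ∉ labels l → x ∈ labels r
∈-right (here x≡b) x≢b _ = contradiction x≡b x≢b
∈-right {l = l} (there x∈) _ x∉l with ∈-++⁻ (labels l) x∈
... | inj₁ x∈l = contradiction x∈l x∉l
... | inj₂ x∈r = x∈r

-- Increasing trees with property P

-- Comb a t: t is increasing, has property P and all its labels are ≥ a.
data Chain : ℕ → Tree → Set where
  leaf : ∀ {a} → Chain a leaf
  node : ∀ {a b l} → a ≤ b → Chain (suc b) l → Chain a (node l b leaf)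

data Comb : ℕ → Tree → Set where
  leaf : ∀ {a} → Comb a leaf
  node : ∀ {a b l r} → a ≤ b → Chain (suc b) l → Comb (suc b) r → Comb a (node l b r)

chain⁺ : ∀ {a} l → T (above a l) → T (increasing l) → T (noRightChild l) → T (propP l) → Chain (suc a) l
chain⁺ leaf _ _ _ _ = leaf
chain⁺ {a} (node l b leaf) a<b inc _ p =
  let b<l , inc′ = T-∧⁻ (above b l) inc
      incl , _   = T-∧⁻ (increasing l) inc′
      nrl , p′   = T-∧⁻ (noRightChild l) p
      pl , _     = T-∧⁻ (propP l) p′
  in node (<ᵇ⇒< a b a<b) (chain⁺ l b<l incl nrl pl)

comb-node⁺ : ∀ {a l b r} → a ≤ b → T (increasing (node l b r)) → T (propP (node l b r)) → Comb a (node l b r)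
comb⁺ : ∀ {a} t → T (above a t) → T (increasing t) → T (propP t) → Comb (suc a) t

comb-node⁺ {l = l} {b} {r} a≤b inc p =
  let b<l , inc₁  = T-∧⁻ (above b l) inc
      b<r , inc₂  = T-∧⁻ (above b r) inc₁
      incl , incr = T-∧⁻ (increasing l) inc₂
      nrl , p₁    = T-∧⁻ (noRightChild l) p
      pl , pr     = T-∧⁻ (propP l) p₁
  in node a≤b (chain⁺ l b<l incl nrl pl) (comb⁺ r b<r incr pr)

comb⁺ leaf             _   _   _ = leaf
comb⁺ {a} (node _ b _) a<b inc p = comb-node⁺ (<ᵇ⇒< a b a<b) inc p

comb⁺₀ : ∀ t → T (increasing t) → T (propP t) → Comb 0 t
comb⁺₀ leaf         _   _ = leaf
comb⁺₀ (node _ _ _) inc p = comb-node⁺ z≤n inc p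

chain-above : ∀ {a l} → Chain (suc a) l → T (above a l)
chain-above leaf         = tt
chain-above (node a<b _) = <⇒<ᵇ a<b

comb-above : ∀ {a t} → Comb (suc a) t → T (above a t)
comb-above leaf           = tt
comb-above (node a<b _ _) = <⇒<ᵇ a<b

chain⁻ : ∀ {a l} → Chain a l → T (increasing l) × T (noRightChild l) × T (propP l)
chain⁻ leaf        = tt , tt , tt
chain⁻ (node _ ch) =
  let inc , nr , p = chain⁻ ch
  in T-∧⁺ (chain-above ch) (T-∧⁺ inc tt) , tt , T-∧⁺ nr (T-∧⁺ p tt)

comb⁻ : ∀ {a t} → Comb a t → T (increasing t) × T (propP t)
comb⁻ leaf           = tt , tt
comb⁻ (node _ ch cr) =
  let incl , nrl , pl = chain⁻ ch
      incr , pr       = comb⁻ cr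
  in T-∧⁺ (chain-above ch) (T-∧⁺ (comb-above cr) (T-∧⁺ incl incr)) , T-∧⁺ nrl (T-∧⁺ pl pr)

chain-leaf : ∀ {x t} → Chain (suc x) t → All (_≤ x) (labels t) → t ≡ leaf
chain-leaf leaf         _         = refl
chain-leaf (node x<b _) (b≤x ∷ _) = contradiction b≤x (<⇒≱ x<b)

comb-leaf : ∀ {x t} → Comb (suc x) t → All (_≤ x) (labels t) → t ≡ leaf
comb-leaf leaf           _         = refl
comb-leaf (node x<b _ _) (b≤x ∷ _) = contradiction b≤x (<⇒≱ x<b)

chain-extendLeftPath : ∀ {a x l} → a ≤ x → All (_< x) (labels l) → Chain a l → Chain a (extendLeftPath x l)
chain-extendLeftPath a≤x _          leaf          = node a≤x leaf
chain-extendLeftPath _   (b<x ∷ <x) (node a≤b ch) = node a≤b (chain-extendLeftPath b<x (++⁻ˡ _ <x) ch)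

chain-trimLeftPath : ∀ {a l} → Chain a l → Chain a (trimLeftPath l)
chain-trimLeftPath leaf                           = leaf
chain-trimLeftPath (node {l = leaf} _ _)          = leaf
chain-trimLeftPath (node {l = node _ _ _} a≤b ch) = node a≤b (chain-trimLeftPath ch)

comb-insert : ∀ {a x t} s → a ≤ x → All (_< x) (labels t) → Comb a t → Comb a (insert x t s)
comb-insert (inj₂ _)       a≤x _          leaf             = node a≤x leaf leaf
comb-insert (inj₁ zero)    _   (b<x ∷ <x) (node a≤b ch cr) =
  node a≤b (chain-extendLeftPath b<x (++⁻ˡ _ <x) ch) cr
comb-insert (inj₁ (suc i)) _   (b<x ∷ <x) (node {l = l} a≤b ch cr) =
  node a≤b ch (comb-insert (inj₁ i) b<x (++⁻ʳ (labels l) <x) cr)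
comb-insert (inj₂ u)       _   (b<x ∷ <x) (node {l = l} a≤b ch cr) =
  node a≤b ch (comb-insert (inj₂ u) b<x (++⁻ʳ (labels l) <x) cr)

comb-delete : ∀ {a} x {t} → Comb a t → Comb a (proj₁ (delete x t))
comb-delete x leaf = leaf
comb-delete x (node {b = b} {l} a≤b ch cr) with x ≟ b | x ∈? labels l
... | yes _ | _     = leaf
... | no _  | yes _ = node a≤b (chain-trimLeftPath ch) cr
... | no _  | no _  = node a≤b ch (comb-delete x cr)

extendLeftPath-trimLeftPath : ∀ {a x l} → Chain a l → x ∈ labels l → All (_≤ x) (labels l) →
                              extendLeftPath x (trimLeftPath l) ≡ l
extendLeftPath-trimLeftPath (node {l = leaf} _ _) (here refl) _ = refl
extendLeftPath-trimLeftPath (node {l = node _ _ _} _ ch) (here refl) (_ ∷ ≤x) =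
  contradiction (chain-leaf ch (++⁻ˡ _ ≤x)) λ ()
extendLeftPath-trimLeftPath (node {l = l@(node _ _ _)} _ ch) (there x∈) (_ ∷ ≤x) with ∈-++⁻ (labels l) x∈
... | inj₁ x∈l = cong (λ l → node l _ leaf) (extendLeftPath-trimLeftPath ch x∈l (++⁻ˡ _ ≤x))

insert-delete : ∀ {a x t} → Comb a t → x ∈ labels t → All (_≤ x) (labels t) →
                uncurry (insert x) (delete x t) ≡ t
insert-delete {x = x} (node {b = b} {l} {r} _ chl cr) x∈ (_ ∷ ≤x) with x ≟ b | x ∈? labels l
... | yes refl | _       =
  cong₂ (λ l r → node l x r) (sym (chain-leaf chl (++⁻ˡ (labels l) ≤x))) (sym (comb-leaf cr (++⁻ʳ (labels l) ≤x)))
... | no _     | yes x∈l =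
  cong (λ l → node l b r) (extendLeftPath-trimLeftPath chl x∈l (++⁻ˡ (labels l) ≤x))
... | no x≢b   | no x∉l  =
  trans (insert-right x l b (delete x r))
        (cong (node l b) (insert-delete cr (∈-right x∈ x≢b x∉l) (++⁻ʳ (labels l) ≤x)))

-- T-shelves with property P

IsShelf : ℕ → Tree → Set
IsShelf n t = labels t ↭ applyDownFrom suc n × Comb 0 t

isShelf⇔ : ∀ n t → T (isTShelf n t ∧ propP t) ⇔ IsShelf n t
isShelf⇔ n t = mk⇔ to from
  where
  to : T (isTShelf n t ∧ propP t) → IsShelf n t
  to s =
    let lb∧inc , p = T-∧⁻ (isTShelf n t) s
        lb , inc   = T-∧⁻ (labelledBy n t) lb∧inc
    in Equivalence.to (labelledBy⇔ n t) lb , comb⁺₀ t inc p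
  from : IsShelf n t → T (isTShelf n t ∧ propP t)
  from (ls , c) =
    let inc , p = comb⁻ c
    in T-∧⁺ (T-∧⁺ (Equivalence.from (labelledBy⇔ n t) ls) inc) p

shelf : ∀ {n} (b : B n) → IsShelf n (proj₁ b)
shelf (t , p) = Equivalence.to (isShelf⇔ _ t) p

B-≡ : ∀ {n} {b b′ : B n} → proj₁ b ≡ proj₁ b′ → b ≡ b′
B-≡ {b = t , p} {.t , q} refl = cong (t ,_) (T-irrelevant p q)

labels≤ : ∀ {n t} → IsShelf n t → All (_≤ n) (labels t)
labels≤ {n} (ls , _) = All-resp-↭ (↭-sym ls) (applyDownFrom-≤ n)

insert-isShelf : ∀ {n t} → IsShelf n t → (s : Slot t) → IsShelf (suc n) (insert (suc n) t s)
insert-isShelf {n} {t} sh@(ls , c) s =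
  ↭-trans (labels-insert (suc n) t s) (prep (suc n) ls) , comb-insert s z≤n (All.map s≤s (labels≤ sh)) c

insert-delete-isShelf : ∀ {n t} → IsShelf (suc n) t → uncurry (insert (suc n)) (delete (suc n) t) ≡ t
insert-delete-isShelf sh@(ls , c) = insert-delete c (∈-resp-↭ (↭-sym ls) (here refl)) (labels≤ sh)

delete-isShelf : ∀ {n t} → IsShelf (suc n) t → IsShelf n (proj₁ (delete (suc n) t))
delete-isShelf {n} {t} sh@(ls , c) = drop-∷ n+1∷t′↭ , comb-delete (suc n) c
  where
  t′ = proj₁ (delete (suc n) t)
  n+1∷t′↭ : suc n ∷ labels t′ ↭ suc n ∷ applyDownFrom suc n
  n+1∷t′↭ = ↭-trans (↭-sym (labels-insert (suc n) t′ (proj₂ (delete (suc n) t))))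
                    (subst (λ u → labels u ↭ _) (sym (insert-delete-isShelf sh)) ls)

B-suc↔ : ∀ n → Σ (B n) (Slot ∘ proj₁) ↔ B (suc n)
B-suc↔ n = mk↔ₛ′ insertMax deleteMax insert∘delete delete∘insert
  where
  insertMax : Σ (B n) (Slot ∘ proj₁) → B (suc n)
  insertMax (b , s) =
    insert (suc n) (proj₁ b) s , Equivalence.from (isShelf⇔ _ _) (insert-isShelf (shelf b) s)
  deleteMax : B (suc n) → Σ (B n) (Slot ∘ proj₁)
  deleteMax b =
    (proj₁ (delete (suc n) (proj₁ b)) , Equivalence.from (isShelf⇔ _ _) (delete-isShelf (shelf b))) ,
    proj₂ (delete (suc n) (proj₁ b))
  insert∘delete : ∀ b → insertMax (deleteMax b) ≡ b
  insert∘delete b = B-≡ (insert-delete-isShelf (shelf b))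
  lift-≡ : ∀ {t s p} {d : Σ Tree Slot} {q} → d ≡ (t , s) →
           _≡_ {A = Σ (B n) (Slot ∘ proj₁)} ((proj₁ d , q) , proj₂ d) ((t , p) , s)
  lift-≡ {t} {s} refl = cong (λ q → (t , q) , s) (T-irrelevant _ _)
  delete∘insert : ∀ x → deleteMax (insertMax x) ≡ x
  delete∘insert (b@(t , _) , s) = lift-≡ (delete-insert (suc n) t s (All.map s≤s (labels≤ (shelf b))))

spineLengthOf : ∀ {n} → B n → ℕ
spineLengthOf = spineLength ∘ proj₁

BSpine : ℕ → ℕ → Set
BSpine n k = Σ (B n) (λ b → spineLengthOf b ≡ k)

BSpine-≡ : ∀ {n k} {x y : BSpine n k} → proj₁ (proj₁ x) ≡ proj₁ (proj₁ y) → x ≡ y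
BSpine-≡ {x = b , e} {b′ , e′} eq with B-≡ {b = b} {b′} eq
... | refl = cong (b ,_) (≡-irrelevant e e′)

labels≡[]⇒leaf : ∀ {t} → labels t ≡ [] → t ≡ leaf
labels≡[]⇒leaf {leaf} _ = refl

spineLength≡0⇒leaf : ∀ {t} → spineLength t ≡ 0 → t ≡ leaf
spineLength≡0⇒leaf {leaf} _ = refl

B-zero : ∀ (b : B 0) → proj₁ b ≡ leaf
B-zero b = labels≡[]⇒leaf (↭-empty-inv (proj₁ (shelf b)))

spineLength≤length-labels : ∀ t → spineLength t ≤ length (labels t)
spineLength≤length-labels leaf         = z≤n
spineLength≤length-labels (node l a r) =
  s≤s (≤-trans (spineLength≤length-labels r) (≤-trans (m≤n+m _ (length (labels l))) (≤-reflexive (sym (length-++ (labels l))))))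

spineLengthOf< : ∀ {n} (b : B n) → spineLengthOf b < suc n
spineLengthOf< {n} b =
  s≤s (≤-trans (spineLength≤length-labels (proj₁ b))
               (≤-reflexive (trans (↭-length (proj₁ (shelf b))) (length-applyDownFrom suc n))))

BSpine-0-0 : BSpine 0 0 ↔ ⊤
BSpine-0-0 = mk↔ₛ′ (λ _ → tt) (λ _ → (leaf , tt) , refl) (λ _ → refl) (λ x → BSpine-≡ (sym (B-zero (proj₁ x))))

¬BSpine-0-suc : ∀ k → ¬ BSpine 0 (suc k)
¬BSpine-0-suc k (b , e) = 0≢1+n (trans (sym (cong spineLength (B-zero b))) e)

¬BSpine-suc-0 : ∀ n → ¬ BSpine (suc n) 0
¬BSpine-suc-0 n (b , e) with spineLength≡0⇒leaf e | ↭-length (proj₁ (shelf b))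
... | refl | ()

BSpine-suc↔ : ∀ n k → BSpine (suc n) (suc k) ↔ (Fin (suc k) × BSpine n (suc k) ⊎ BSpine n k)
BSpine-suc↔ n k = begin
  BSpine (suc n) (suc k)
    ↔⟨ ↔-sym (Σ-↔ (B-suc↔ n) ↔-refl) ⟩
  Σ (Σ (B n) (Slot ∘ proj₁)) (λ (b , s) → spineLength (ins b s) ≡ suc k)
    ↔⟨ Σ-assoc ⟩
  Σ (B n) (λ b → Σ (Slot (proj₁ b)) (λ s → spineLength (ins b s) ≡ suc k))
    ↔⟨ Σ-↔ ↔-refl Σ-distribʳ-⊎ ⟩
  Σ (B n) (λ b → Σ (Fin (spineLengthOf b)) (λ i → spineLength (ins b (inj₁ i)) ≡ suc k)
               ⊎ Σ ⊤ (λ u → spineLength (ins b (inj₂ u)) ≡ suc k))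
    ↔⟨ Σ-↔ ↔-refl (λ {b} → Σ-↔ ↔-refl (≡-substˡ-↔ (spineLength-insert₁ _ (proj₁ b) _))
                         ⊎-↔ Σ-↔ ↔-refl (≡-substˡ-↔ (spineLength-insert₂ _ (proj₁ b) _))) ⟩
  Σ (B n) (λ b → Fin (spineLengthOf b) × spineLengthOf b ≡ suc k ⊎ ⊤ × suc (spineLengthOf b) ≡ suc k)
    ↔⟨ Σ-distribˡ-⊎ ⟩
  (Σ (B n) (λ b → Fin (spineLengthOf b) × spineLengthOf b ≡ suc k)
     ⊎ Σ (B n) (λ b → ⊤ × suc (spineLengthOf b) ≡ suc k))
    ↔⟨ Fin-×-fibre↔ spineLengthOf ⊎-↔ Σ-↔ ↔-refl (↔-trans ⊤×↔ suc≡suc↔) ⟩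
  (Fin (suc k) × BSpine n (suc k) ⊎ BSpine n k) ∎
  where
  open EquationalReasoning
  ins : (b : B n) → Slot (proj₁ b) → Tree
  ins b = insert (suc n) (proj₁ b)

BSpine↔stirling2 : ∀ n k → BSpine n k ↔ Fin (stirling2 n k)
BSpine↔stirling2 = stirling2-↔ BSpine BSpine-0-0 ¬BSpine-0-suc ¬BSpine-suc-0 BSpine-suc↔

corollary2 : (n : ℕ) → B n ↔ Fin (bell n)
corollary2 n = begin
  B n
    ↔⟨ ↔Σ-fibres spineLengthOf spineLengthOf< ⟩
  Σ (Fin (suc n)) (λ i → BSpine n (toℕ i))
    ↔⟨ Σ-↔ ↔-refl (BSpine↔stirling2 n _) ⟩
  Σ (Fin (suc n)) (λ i → Fin (stirling2 n (toℕ i)))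
    ↔⟨ ↔-sym (Fin-sum-upTo↔ (stirling2 n) (suc n)) ⟩
  Fin (bell n) ∎
  where open EquationalReasoning
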